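{- Let $D$ be a digraph without digons of order $n$, and let $k,l$ be integers with $2\leq k\leq \min\{l,n\}$. Let $\alpha$ and $\beta$ be two $l$-colorings of $D$ such that the color classes $C_1^\beta,C_2^\beta,\dots,C_k^\beta$ of $\beta$ are singletons, and $\alpha(u)=\beta(u)$ for each $u\in V(D)\setminus\bigcup_{i=1}^k C_i^\beta$. Then $d(\alpha,\beta)\leq k$ in $\mathcal{D}_l(D)$.
   Context: All digraphs are finite, loopless and without digons. For a digraph $D$ and a positive integer $l$, an $l$-coloring of $D$ is a function $\alpha\colon V(D)\to\{1,\dots,l\}$ such that every color class $C_i^\alpha=\{x\in V(D):\alpha(x)=i\}$ (possibly empty) induces an acyclic subdigraph. The $l$-dicoloring graph $\mathcal{D}_l(D)$ has the $l$-colorings of $D$ as vertices, two being adjacent iff they differ on exactly one vertex; $d(\alpha,\beta)$ denotes the distance in this graph. -}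

module Defs where

open import Data.Nat using (ℕ; zero; suc; _≤_; _<_)
open import Data.Fin using (Fin; zero; suc; toℕ; inject₁; fromℕ)
open import Data.Product using (Σ; ∃; _×_; _,_; proj₁)
open import Data.Empty using (⊥)
open import Relation.Nullary using (¬_)
open import Relation.Binary.PropositionalEquality using (_≡_; _≢_)
open import Function.Definitions using (Injective)

record Digraph (n : ℕ) : Set₁ where
  field
    Arc      : Fin n → Fin n → Set
    loopless : ∀ x → ¬ Arc x x
    noDigon  : ∀ x y → Arc x y → ¬ Arc y x
open Digraph public

record CycleIn {n : ℕ} (D : Digraph n) (S : Fin n → Set) : Set where
  field
    m        : ℕ
    v        : Fin (suc m) → Fin n
    distinct : Injective _≡_ _≡_ v
    inS      : ∀ i → S (v i)
    step     : ∀ (i : Fin m) → Arc D (v (inject₁ i)) (v (suc i))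
    close    : Arc D (v (fromℕ m)) (v zero)

Acyclic : ∀ {n} → Digraph n → (Fin n → Set) → Set
Acyclic D S = ¬ CycleIn D S

-- Colour i ∈ Fin l stands for colour (toℕ i + 1) of the paper.
ColorClass : ∀ {n l} → (Fin n → Fin l) → Fin l → Fin n → Set
ColorClass α c x = α x ≡ c

IsColoring : ∀ {n} (D : Digraph n) (l : ℕ) → (Fin n → Fin l) → Set
IsColoring D l α = ∀ (c : Fin l) → Acyclic D (ColorClass α c)

Coloring : ∀ {n} → Digraph n → ℕ → Set
Coloring {n} D l = Σ (Fin n → Fin l) (IsColoring D l)

Adjacent : ∀ {n} {D : Digraph n} {l : ℕ} → Coloring D l → Coloring D l → Set
Adjacent {n} (α , _) (β , _) =
  Σ (Fin n) λ v → (α v ≢ β v) × (∀ w → w ≢ v → α w ≡ β w)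

-- Walk D l m α β : a walk of length m from α to β in 𝒟_l(D)
-- (equality of colorings is pointwise equality of the colour functions)
data Walk {n : ℕ} (D : Digraph n) (l : ℕ) : ℕ → Coloring D l → Coloring D l → Set where
  done : ∀ {α β} → (∀ x → proj₁ α x ≡ proj₁ β x) → Walk D l zero α β
  step : ∀ {m α γ β} → Adjacent {D = D} α γ → Walk D l m γ β → Walk D l (suc m) α β

DistLe : ∀ {n} (D : Digraph n) (l : ℕ) → Coloring D l → Coloring D l → ℕ → Set
DistLe D l α β k = Σ ℕ λ m → (m ≤ k) × Walk D l m α β

Singleton : ∀ {n l} → (Fin n → Fin l) → Fin l → Set
Singleton {n} β c = Σ (Fin n) λ x → (β x ≡ c) × (∀ y → β y ≡ c → y ≡ x)

{-# OPTIONS --safe #-}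
-- Let x₁, …, x_k be the vertices forming the singleton classes C₁^β, …, C_k^β.
-- Off these vertices α agrees with β, so for i ≤ k every α-class of colour i lies
-- inside {x₁, …, x_k}. These k vertices cannot meet each of the k colours twice,
-- so some colour i ≤ k is used by α at most once. Recolouring x_i with i then
-- makes class i have at most two vertices, hence acyclic because D has neither
-- loops nor digons. The new colouring agrees with β off the remaining k − 1
-- singletons, and induction on k gives a walk of length at most k.
module Submission where

open import Defs
open import Data.Nat using (ℕ; zero; suc; _≤_; _<_; z≤n; s≤s)
open import Data.Nat.Properties using (≮⇒≥; m<m+n; m≤n⇒m≤1+n)
open import Data.Fin using (Fin; zero; suc; toℕ; punchIn; punchOut; splitAt; inject≤; fromℕ<)
open import Data.Fin.Properties
  using (_≟_; any?; ¬∀⟶∃¬; <⇒notInjective; +↔⊎; 0≢1+n; suc-injective; toℕ<n; toℕ-injective;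
         toℕ-inject≤; toℕ-fromℕ<; inject≤-injective; punchIn-injective; punchIn-punchOut)
open import Data.Vec.Functional using (updateAt)
open import Data.Vec.Functional.Properties using (updateAt-updates; updateAt-minimal)
open import Data.Product using (∃; ∃₂; _×_; _,_; proj₁; proj₂)
open import Data.Sum using (_⊎_; inj₁; inj₂)
open import Function using (_∘_; const)
open import Function.Bundles using (Injection)
open import Function.Definitions using (Injective)
open import Function.Properties.Inverse using (Inverse⇒Injection)
open import Relation.Binary.Definitions using (DecidableEquality)
open import Relation.Binary.PropositionalEquality using (_≡_; _≢_; _≗_; refl; sym; trans; cong; subst)
open import Relation.Nullary using (¬_; Dec; yes; no; contradiction)
open import Relation.Nullary.Decidable using (¬?; _×-dec_)
open import Relation.Unary using (Pred; _⊆_)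
open import Level using (0ℓ)

AtMostTwo : ∀ {n} → Pred (Fin n) 0ℓ → Set
AtMostTwo S = ∀ {p q r} → S p → S q → S r → p ≡ q ⊎ p ≡ r ⊎ q ≡ r

insert-atMostTwo : ∀ {n} {S : Pred (Fin n) 0ℓ} (x : Fin n) →
  (∀ {y z} → S y → S z → y ≡ z) → AtMostTwo (λ y → y ≡ x ⊎ S y)
insert-atMostTwo x S≤1 (inj₁ p≡x) (inj₁ q≡x) _          = inj₁ (trans p≡x (sym q≡x))
insert-atMostTwo x S≤1 (inj₁ p≡x) (inj₂ _)   (inj₁ r≡x) = inj₂ (inj₁ (trans p≡x (sym r≡x)))
insert-atMostTwo x S≤1 (inj₁ _)   (inj₂ Sq)  (inj₂ Sr)  = inj₂ (inj₂ (S≤1 Sq Sr))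
insert-atMostTwo x S≤1 (inj₂ _)   (inj₁ q≡x) (inj₁ r≡x) = inj₂ (inj₂ (trans q≡x (sym r≡x)))
insert-atMostTwo x S≤1 (inj₂ Sp)  (inj₁ _)   (inj₂ Sr)  = inj₂ (inj₁ (S≤1 Sp Sr))
insert-atMostTwo x S≤1 (inj₂ Sp)  (inj₂ Sq)  _          = inj₁ (S≤1 Sp Sq)

module _ {n : ℕ} (D : Digraph n) where

  acyclic-⊆ : ∀ {S T : Pred (Fin n) 0ℓ} → S ⊆ T → Acyclic D T → Acyclic D S
  acyclic-⊆ S⊆T T-acyclic C = T-acyclic (record
    { m = m ; v = v ; distinct = distinct ; inS = S⊆T ∘ inS ; step = CycleIn.step C ; close = close })
    where open CycleIn C hiding (step)

  atMostTwo⇒acyclic : ∀ {S : Pred (Fin n) 0ℓ} → AtMostTwo S → Acyclic D S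
  atMostTwo⇒acyclic _ record { m = zero ; v = v ; close = v₀→v₀ } = loopless D (v zero) v₀→v₀
  atMostTwo⇒acyclic _ record { m = suc zero ; v = v ; step = arcs ; close = v₁→v₀ } =
    noDigon D (v zero) (v (suc zero)) (arcs zero) v₁→v₀
  atMostTwo⇒acyclic S≤2 record { m = suc (suc _) ; distinct = distinct ; inS = inS }
    with S≤2 (inS zero) (inS (suc zero)) (inS (suc (suc zero)))
  ... | inj₁ v₀≡v₁        = 0≢1+n (distinct v₀≡v₁)
  ... | inj₂ (inj₁ v₀≡v₂) = 0≢1+n (distinct v₀≡v₂)
  ... | inj₂ (inj₂ v₁≡v₂) = 0≢1+n (suc-injective (distinct v₁≡v₂))

module _ {n l : ℕ} (D : Digraph n) where

  updateAt-colorClass : ∀ (a : Fin n → Fin l) x c {c′ y} →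
    ColorClass (updateAt a x (const c)) c′ y → (y ≡ x × c ≡ c′) ⊎ ColorClass a c′ y
  updateAt-colorClass a x c {y = y} a′y≡c′ with y ≟ x
  ... | yes refl = inj₁ (refl , trans (sym (updateAt-updates x a)) a′y≡c′)
  ... | no y≢x   = inj₂ (trans (sym (updateAt-minimal y x a y≢x)) a′y≡c′)

  updateAt-isColoring : ∀ {a : Fin n → Fin l} {x c} → IsColoring D l a →
    Acyclic D (λ y → y ≡ x ⊎ ColorClass a c y) → IsColoring D l (updateAt a x (const c))
  updateAt-isColoring {a} {x} {c} a-coloring new-class-acyclic c′ with c ≟ c′
  ... | yes refl = acyclic-⊆ D new-class new-class-acyclic
    where
    new-class : ColorClass (updateAt a x (const c)) c ⊆ (λ y → y ≡ x ⊎ ColorClass a c y)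
    new-class a′y≡c with updateAt-colorClass a x c a′y≡c
    ... | inj₁ (y≡x , _) = inj₁ y≡x
    ... | inj₂ ay≡c      = inj₂ ay≡c
  ... | no c≢c′ = acyclic-⊆ D old-class (a-coloring c′)
    where
    old-class : ColorClass (updateAt a x (const c)) c′ ⊆ ColorClass a c′
    old-class a′y≡c′ with updateAt-colorClass a x c a′y≡c′
    ... | inj₁ (_ , c≡c′) = contradiction c≡c′ c≢c′
    ... | inj₂ ay≡c′      = ay≡c′

module _ {n : ℕ} {D : Digraph n} {l : ℕ} where

  walk-resp-≗ : ∀ {m} {α α′ β : Coloring D l} →
    proj₁ α ≗ proj₁ α′ → Walk D l m α′ β → Walk D l m α β
  walk-resp-≗ α≗α′ (done α′≗β) = done (λ y → trans (α≗α′ y) (α′≗β y))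
  walk-resp-≗ α≗α′ (step (v , α′v≢γv , α′≗γ-off-v) walk) =
    step (v , (α′v≢γv ∘ trans (sym (α≗α′ v))) , (λ w w≢v → trans (α≗α′ w) (α′≗γ-off-v w w≢v))) walk

  distLe-recolor : ∀ {m} {α α′ β : Coloring D l} x →
    (∀ y → y ≢ x → proj₁ α y ≡ proj₁ α′ y) → DistLe D l α′ β m → DistLe D l α β (suc m)
  distLe-recolor {α = a , _} {a′ , _} x a≡a′-off-x (m , m≤ , walk) with a x ≟ a′ x
  ... | yes ax≡a′x = m , m≤n⇒m≤1+n m≤ , walk-resp-≗ a≗a′ walk
    where
    a≗a′ : a ≗ a′
    a≗a′ y with y ≟ x
    ... | yes refl = ax≡a′x
    ... | no y≢x   = a≡a′-off-x y y≢x
  ... | no ax≢a′x = suc m , s≤s m≤ , step (x , ax≢a′x , a≡a′-off-x) walk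

module _ {A : Set} (_≟ᴬ_ : DecidableEquality A) {m : ℕ} (f κ : Fin (suc m) → A) where

  Collision : A → Set
  Collision y = ∃₂ λ d d′ → d ≢ d′ × f d ≡ y × f d′ ≡ y

  -- Two f-preimages for every κ c would inject Fin (suc m) ⊎ Fin (suc m) into Fin (suc m).
  ¬∀-collision : Injective _≡_ _≡_ κ → ¬ (∀ c → Collision (κ c))
  ¬∀-collision κ-injective collision =
    <⇒notInjective (m<m+n (suc m) (s≤s z≤n)) (splitAt-injective ∘ preimage-injective)
    where
    splitAt-injective : Injective _≡_ _≡_ (splitAt (suc m) {suc m})
    splitAt-injective = Injection.injective (Inverse⇒Injection +↔⊎)

    preimage : Fin (suc m) ⊎ Fin (suc m) → Fin (suc m)
    preimage (inj₁ c) = proj₁ (collision c)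
    preimage (inj₂ c) = proj₁ (proj₂ (collision c))

    target : Fin (suc m) ⊎ Fin (suc m) → Fin (suc m)
    target (inj₁ c) = c
    target (inj₂ c) = c

    f∘preimage : ∀ s → f (preimage s) ≡ κ (target s)
    f∘preimage (inj₁ c) = proj₁ (proj₂ (proj₂ (proj₂ (collision c))))
    f∘preimage (inj₂ c) = proj₂ (proj₂ (proj₂ (proj₂ (collision c))))

    target-cong : ∀ s s′ → preimage s ≡ preimage s′ → target s ≡ target s′
    target-cong s s′ e = κ-injective (trans (sym (f∘preimage s)) (trans (cong f e) (f∘preimage s′)))

    preimage-injective : Injective _≡_ _≡_ preimage
    preimage-injective {inj₁ c} {inj₁ c′} e with refl ← target-cong (inj₁ c) (inj₁ c′) e = refl
    preimage-injective {inj₂ c} {inj₂ c′} e with refl ← target-cong (inj₂ c) (inj₂ c′) e = refl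
    preimage-injective {inj₁ c} {inj₂ c′} e with refl ← target-cong (inj₁ c) (inj₂ c′) e =
      contradiction e (proj₁ (proj₂ (proj₂ (collision c))))
    preimage-injective {inj₂ c} {inj₁ c′} e with refl ← target-cong (inj₂ c) (inj₁ c′) e =
      contradiction (sym e) (proj₁ (proj₂ (proj₂ (collision c))))

  collision? : ∀ y → Dec (Collision y)
  collision? y = any? λ d → any? λ d′ → ¬? (d ≟ d′) ×-dec (f d ≟ᴬ y) ×-dec (f d′ ≟ᴬ y)

  ∃-fiber-subsingleton : Injective _≡_ _≡_ κ →
    ∃ λ c → ∀ {d d′} → f d ≡ κ c → f d′ ≡ κ c → d ≡ d′
  ∃-fiber-subsingleton κ-injective
    with ¬∀⟶∃¬ (suc m) (Collision ∘ κ) (collision? ∘ κ) (¬∀-collision κ-injective)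
  ... | c , no-collision = c , fiber-subsingleton
    where
    fiber-subsingleton : ∀ {d d′} → f d ≡ κ c → f d′ ≡ κ c → d ≡ d′
    fiber-subsingleton {d} {d′} fd≡κc fd′≡κc with d ≟ d′
    ... | yes d≡d′ = d≡d′
    ... | no d≢d′  = contradiction (d , d′ , d≢d′ , fd≡κc , fd′≡κc) no-collision

module RecolorSingleton {n l N : ℕ} (D : Digraph n)
  (κ : Fin (suc N) → Fin l) (κ-injective : Injective _≡_ _≡_ κ)
  {a b : Fin n → Fin l} (a-coloring : IsColoring D l a) (singleton : ∀ i → Singleton b (κ i))
  (agree : ∀ u → (∀ j → b u ≢ κ j) → a u ≡ b u) where

  xs : Fin (suc N) → Fin n
  xs i = proj₁ (singleton i)

  b∘xs : ∀ i → b (xs i) ≡ κ i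
  b∘xs i = proj₁ (proj₂ (singleton i))

  xs-unique : ∀ i {y} → b y ≡ κ i → y ≡ xs i
  xs-unique i = proj₂ (proj₂ (singleton i)) _

  colorClass-⊆-xs : ∀ {y} i → a y ≡ κ i → ∃ λ d → y ≡ xs d
  colorClass-⊆-xs {y} i ay≡κi with any? (λ j → b y ≟ κ j)
  ... | yes (j , by≡κj) = j , xs-unique j by≡κj
  ... | no b-y∉κ = i , xs-unique i (trans (sym (agree y λ j by≡κj → b-y∉κ (j , by≡κj))) ay≡κi)

  c : Fin (suc N)
  c = proj₁ (∃-fiber-subsingleton _≟_ (a ∘ xs) κ κ-injective)

  x : Fin n
  x = xs c

  κc-fiber-subsingleton : ∀ {d d′} → a (xs d) ≡ κ c → a (xs d′) ≡ κ c → d ≡ d′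
  κc-fiber-subsingleton = proj₂ (∃-fiber-subsingleton _≟_ (a ∘ xs) κ κ-injective)

  colorClass-subsingleton : ∀ {y z} → a y ≡ κ c → a z ≡ κ c → y ≡ z
  colorClass-subsingleton ay≡κc az≡κc with colorClass-⊆-xs c ay≡κc | colorClass-⊆-xs c az≡κc
  ... | _ , refl | _ , refl = cong xs (κc-fiber-subsingleton ay≡κc az≡κc)

  a′ : Fin n → Fin l
  a′ = updateAt a x (const (κ c))

  a′-coloring : IsColoring D l a′
  a′-coloring = updateAt-isColoring D a-coloring
    (atMostTwo⇒acyclic D (insert-atMostTwo x colorClass-subsingleton))

  agree′ : ∀ u → (∀ j → b u ≢ κ (punchIn c j)) → a′ u ≡ b u
  agree′ u b-u∉κ′ with u ≟ x
  ... | yes refl = trans (updateAt-updates x a) (sym (b∘xs c))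
  ... | no u≢x   = trans (updateAt-minimal u x a u≢x) (agree u b-u∉κ)
    where
    b-u∉κ : ∀ j → b u ≢ κ j
    b-u∉κ j bu≡κj with c ≟ j
    ... | yes refl = u≢x (xs-unique c bu≡κj)
    ... | no c≢j   = b-u∉κ′ (punchOut c≢j) (trans bu≡κj (cong κ (sym (punchIn-punchOut c≢j))))

distLe-singletonClasses : ∀ {n l} (D : Digraph n) N (κ : Fin N → Fin l) → Injective _≡_ _≡_ κ →
  (α β : Coloring D l) → (∀ i → Singleton (proj₁ β) (κ i)) →
  (∀ u → (∀ j → proj₁ β u ≢ κ j) → proj₁ α u ≡ proj₁ β u) →
  DistLe D l α β N
distLe-singletonClasses D zero κ _ α β _ agree = zero , z≤n , done (λ u → agree u λ ())
distLe-singletonClasses D (suc N) κ κ-injective (a , a-coloring) β singleton agree =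
  distLe-recolor x (λ y y≢x → sym (updateAt-minimal y x a y≢x))
    (distLe-singletonClasses D N (κ ∘ punchIn c) (punchIn-injective c _ _ ∘ κ-injective)
      (a′ , a′-coloring) β (singleton ∘ punchIn c) agree′)
  where open RecolorSingleton D κ κ-injective a-coloring singleton agree

lemma1 : ∀ {n : ℕ} (D : Digraph n) (k l : ℕ) →
    2 ≤ k → k ≤ l → k ≤ n →
    (α β : Coloring D l) →
    (∀ (c : Fin l) → toℕ c < k → Singleton (proj₁ β) c) →
    (∀ (u : Fin n) → k ≤ toℕ (proj₁ β u) → proj₁ α u ≡ proj₁ β u) →
    DistLe D l α β k
lemma1 D k l _ k≤l _ α β singleton agree =
  distLe-singletonClasses D k κ κ-injective α β (λ i → singleton (κ i) (toℕ-κ<k i))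
    (λ u β-u∉κ → agree u (≮⇒≥ λ toℕβu<k → β-u∉κ (fromℕ< toℕβu<k) (κ-fromℕ< toℕβu<k)))
  where
  κ : Fin k → Fin l
  κ i = inject≤ i k≤l

  κ-injective : Injective _≡_ _≡_ κ
  κ-injective = inject≤-injective k≤l k≤l _ _

  toℕ-κ<k : ∀ i → toℕ (κ i) < k
  toℕ-κ<k i = subst (_< k) (sym (toℕ-inject≤ i k≤l)) (toℕ<n i)

  κ-fromℕ< : ∀ {c : Fin l} (toℕc<k : toℕ c < k) → c ≡ κ (fromℕ< toℕc<k)
  κ-fromℕ< toℕc<k = toℕ-injective (sym (trans (toℕ-inject≤ _ k≤l) (toℕ-fromℕ< toℕc<k)))
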